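{- Let $\beta$ be a positive integer and let $\varphi_1$ be the CFLS coloring on $V=\{0,1\}^{\beta^2}$. Then there is no odd $k\ge 3$ and no sequence of distinct vertices $v_1,\ldots,v_k \in V$ with $\varphi_1(v_1,v_2)=\varphi_1(v_2,v_3)=\cdots=\varphi_1(v_{k-1},v_k)=\varphi_1(v_k,v_1)$; that is, $\varphi_1$ has no monochromatic odd cycle.
   Context: Let $\beta$ be a positive integer and $V=\{0,1\}^{\beta^2}$. For $v\in V$ write $v=(v^{(1)},\ldots,v^{(\beta)})$ where each block $v^{(i)}\in\{0,1\}^\beta$ consists of consecutive bits of $v$. The CFLS coloring of the edges of the complete graph on $V$ is defined, for distinct $x,y\in V$, by \[\varphi_1(x,y)=\big((i,\{x^{(i)},y^{(i)}\}),\, i_1,\ldots,i_\beta\big),\] where $i$ is the first index with $x^{(i)}\neq y^{(i)}$, and for each $k=1,\ldots,\beta$, $i_k=0$ if $x^{(k)}=y^{(k)}$ and otherwise $i_k$ is the first position at which a bit of $x^{(k)}$ differs from the corresponding bit of $y^{(k)}$. -}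

module Defs where

open import Data.Bool using (Bool)
import Data.Bool as B
open import Data.Nat using (ℕ; zero; suc; _*_; _<?_)
open import Data.Fin using (Fin; toℕ; fromℕ<; combine)
import Data.Fin as F
open import Data.Vec using (Vec; []; _∷_; lookup; tabulate)
open import Data.Vec.Properties using (≡-dec)
open import Data.Maybe using (Maybe; just; nothing)
import Data.Maybe as M
open import Data.Product using (_×_; _,_)
open import Data.Sum using (_⊎_)
open import Relation.Binary.PropositionalEquality using (_≡_)
open import Relation.Binary.Definitions using (DecidableEquality)
open import Relation.Nullary using (yes; no)

V : ℕ → Set
V β = Vec Bool (β * β)

block : ∀ β → V β → Fin β → Vec Bool β
block β x k = tabulate λ j → lookup x (combine k j)

firstDiff : ∀ {A : Set} {n} → DecidableEquality A → Vec A n → Vec A n → Maybe (Fin n)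
firstDiff _≟_ [] [] = nothing
firstDiff _≟_ (a ∷ as) (b ∷ bs) with a ≟ b
... | no _ = just F.zero
... | yes _ = M.map F.suc (firstDiff _≟_ as bs)

blocks : ∀ β → V β → Vec (Vec Bool β) β
blocks β x = tabulate (block β x)

-- i_k : 0 if x^{(k)} = y^{(k)}, otherwise the (1-based) first differing position.
idx : ∀ β → V β → V β → Fin β → ℕ
idx β x y k with firstDiff B._≟_ (block β x k) (block β y k)
... | nothing = 0
... | just j = suc (toℕ j)

-- A colour: (first differing block index i, the pair {x^{(i)}, y^{(i)}}), i_1..i_β.
-- The pair is stored as an ordered pair; colours are compared up to swapping it.
record Colour (β : ℕ) : Set where
  constructor colour
  field
    first : Maybe (Fin β)
    pair  : Maybe (Vec Bool β × Vec Bool β)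
    idxs  : Vec ℕ β

-- The CFLS colouring φ₁ (meaningful for x ≠ y, where `first` is `just i`).
φ₁ : ∀ β → V β → V β → Colour β
φ₁ β x y = colour i (M.map (λ k → block β x k , block β y k) i) (tabulate (idx β x y))
  where i = firstDiff (≡-dec B._≟_) (blocks β x) (blocks β y)

UPairEq : {A : Set} → A × A → A × A → Set
UPairEq (a , b) (c , d) = (a ≡ c × b ≡ d) ⊎ (a ≡ d × b ≡ c)

data MaybeRel {A : Set} (R : A → A → Set) : Maybe A → Maybe A → Set where
  nothing : MaybeRel R nothing nothing
  just    : ∀ {a b} → R a b → MaybeRel R (just a) (just b)

SameColour : ∀ {β} → Colour β → Colour β → Set
SameColour (colour f p is) (colour f' p' is') =
  f ≡ f' × MaybeRel UPairEq p p' × is ≡ is'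

cycSucc : ∀ {n} → Fin n → Fin n
cycSucc {suc m} j with suc (toℕ j) <? suc m
... | yes p = fromℕ< p
... | no _ = F.zero

-- All edges of a monochromatic cycle share the colour's first component i, hence first
-- differ in the same block i, and share its unordered pair {a, b} of i-th blocks with a ≠ b.
-- So the i-th block of the vertices alternates between a and b around the cycle, and a
-- closed walk that alternates between two distinct values has even length.
module Submission where

open import Defs
open import Data.Nat using (ℕ; zero; suc; s≤s; _≤_; _<_; _<?_; _%_; parity)
open import Data.Nat.Properties using (<-trans; n<1+n; <-irrefl)
open import Data.Nat.GeneralisedArithmetic using (fold)
open import Data.Parity.Base using (Parity; 0ℙ; 1ℙ; _⁻¹) renaming (_+_ to _+ℙ_)
open import Data.Parity.Properties using (⁻¹-involutive; +-cancelʳ-≡; p≢p⁻¹)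
open import Data.Fin using (Fin; toℕ; fromℕ; combine)
import Data.Fin as F
open import Data.Fin.Properties using (toℕ-injective; toℕ-fromℕ; toℕ-fromℕ<; combine-surjective; 0≢1+n)
open import Data.Bool using (Bool)
open import Data.Vec using (Vec; []; _∷_; lookup; tabulate)
open import Data.Vec.Properties using (lookup∘tabulate; tabulate∘lookup; tabulate-cong)
open import Data.Maybe using (Maybe; just; nothing)
import Data.Maybe as M
open import Data.Product using (_,_; ∃)
open import Data.Sum using (inj₁; inj₂)
open import Data.Empty using (⊥-elim)
open import Function using (_∘_)
open import Relation.Binary.PropositionalEquality
open import Relation.Binary.Definitions using (DecidableEquality)
open import Relation.Nullary using (¬_; yes; no)

firstDiff-nothing⇒≡ : ∀ {A : Set} {n} (_≟_ : DecidableEquality A) (xs ys : Vec A n) →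
  firstDiff _≟_ xs ys ≡ nothing → xs ≡ ys
firstDiff-nothing⇒≡ _≟_ [] [] _ = refl
firstDiff-nothing⇒≡ _≟_ (a ∷ as) (b ∷ bs) e with a ≟ b
firstDiff-nothing⇒≡ _≟_ (a ∷ as) (b ∷ bs) () | no _
... | yes refl with firstDiff _≟_ as bs in e′
...   | nothing = cong (a ∷_) (firstDiff-nothing⇒≡ _≟_ as bs e′)
firstDiff-nothing⇒≡ _≟_ (a ∷ as) (b ∷ bs) () | yes refl | just _

firstDiff-just⇒lookup≢ : ∀ {A : Set} {n} (_≟_ : DecidableEquality A) (xs ys : Vec A n) i →
  firstDiff _≟_ xs ys ≡ just i → lookup xs i ≢ lookup ys i
firstDiff-just⇒lookup≢ _≟_ (a ∷ as) (b ∷ bs) i e with a ≟ b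
firstDiff-just⇒lookup≢ _≟_ (a ∷ as) (b ∷ bs) .F.zero refl | no a≢b = a≢b
... | yes _ with firstDiff _≟_ as bs in e′
firstDiff-just⇒lookup≢ _≟_ (a ∷ as) (b ∷ bs) .(F.suc j) refl | yes _ | just j =
  firstDiff-just⇒lookup≢ _≟_ as bs j e′

lookup-blocks : ∀ β (x : V β) k j → lookup (lookup (blocks β x) k) j ≡ lookup x (combine k j)
lookup-blocks β x k j = begin
  lookup (lookup (blocks β x) k) j  ≡⟨ cong (λ w → lookup w j) (lookup∘tabulate (block β x) k) ⟩
  lookup (block β x k) j            ≡⟨ lookup∘tabulate _ j ⟩
  lookup x (combine k j)            ∎
  where open ≡-Reasoning

blocks-injective : ∀ β {x y : V β} → blocks β x ≡ blocks β y → x ≡ y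
blocks-injective β {x} {y} e = begin
  x                    ≡⟨ tabulate∘lookup x ⟨
  tabulate (lookup x)  ≡⟨ tabulate-cong lookup-x≗lookup-y ⟩
  tabulate (lookup y)  ≡⟨ tabulate∘lookup y ⟩
  y                    ∎
  where
  open ≡-Reasoning
  lookup-x≗lookup-y : ∀ p → lookup x p ≡ lookup y p
  lookup-x≗lookup-y p with k , j , refl ← combine-surjective {β} {β} p = begin
    lookup x (combine k j)            ≡⟨ lookup-blocks β x k j ⟨
    lookup (lookup (blocks β x) k) j  ≡⟨ cong (λ bs → lookup (lookup bs k) j) e ⟩
    lookup (lookup (blocks β y) k) j  ≡⟨ lookup-blocks β y k j ⟩
    lookup y (combine k j)            ∎

φ₁-first≡nothing⇒≡ : ∀ β (x y : V β) → Colour.first (φ₁ β x y) ≡ nothing → x ≡ y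
φ₁-first≡nothing⇒≡ β x y = blocks-injective β ∘ firstDiff-nothing⇒≡ _ (blocks β x) (blocks β y)

φ₁-first≡just⇒block≢ : ∀ β (x y : V β) {i} → Colour.first (φ₁ β x y) ≡ just i →
  block β x i ≢ block β y i
φ₁-first≡just⇒block≢ β x y {i} e xᵢ≡yᵢ =
  firstDiff-just⇒lookup≢ _ (blocks β x) (blocks β y) i e (begin
    lookup (blocks β x) i  ≡⟨ lookup∘tabulate (block β x) i ⟩
    block β x i            ≡⟨ xᵢ≡yᵢ ⟩
    block β y i            ≡⟨ lookup∘tabulate (block β y) i ⟨
    lookup (blocks β y) i  ∎)
  where open ≡-Reasoning

maybeRel-map⁻¹ : ∀ {A B : Set} {R : B → B → Set} {f g : A → B} {m m′ : Maybe A} {a} →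
  m ≡ just a → m′ ≡ just a → MaybeRel R (M.map f m) (M.map g m′) → R (f a) (g a)
maybeRel-map⁻¹ refl refl (just r) = r

sameColour⇒samePair : ∀ β (x y x′ y′ : V β) {i} → Colour.first (φ₁ β x′ y′) ≡ just i →
  SameColour (φ₁ β x y) (φ₁ β x′ y′) →
  UPairEq (block β x i , block β y i) (block β x′ i , block β y′ i)
sameColour⇒samePair β _ _ _ _ e (first≡ , pair≈ , _) = maybeRel-map⁻¹ (trans first≡ e) e pair≈

module Alternation {A : Set} {a b : A} (a≢b : a ≢ b) where

  pick : Parity → A
  pick 0ℙ = a
  pick 1ℙ = b

  pick-injective : ∀ {p q} → pick p ≡ pick q → p ≡ q
  pick-injective {0ℙ} {0ℙ} _ = refl
  pick-injective {0ℙ} {1ℙ} e = ⊥-elim (a≢b e)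
  pick-injective {1ℙ} {0ℙ} e = ⊥-elim (a≢b (sym e))
  pick-injective {1ℙ} {1ℙ} _ = refl

  endpoint-picked : ∀ {u w : A} → UPairEq (u , w) (a , b) → ∃ λ p → u ≡ pick p
  endpoint-picked (inj₁ (u≡a , _)) = 0ℙ , u≡a
  endpoint-picked (inj₂ (u≡b , _)) = 1ℙ , u≡b

  edge-flips : ∀ {u w : A} {p} → UPairEq (u , w) (a , b) → u ≡ pick p → w ≡ pick (p ⁻¹)
  edge-flips {p = 0ℙ} (inj₁ (_ , w≡b)) _ = w≡b
  edge-flips {p = 1ℙ} (inj₁ (u≡a , _)) u≡b = ⊥-elim (a≢b (trans (sym u≡a) u≡b))
  edge-flips {p = 0ℙ} (inj₂ (u≡b , _)) u≡a = ⊥-elim (a≢b (trans (sym u≡a) u≡b))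
  edge-flips {p = 1ℙ} (inj₂ (_ , w≡a)) _ = w≡a

  module _ {X : Set} (s : X → X) (c : X → A) (edge : ∀ x → UPairEq (c x , c (s x)) (a , b)) where

    walk-alternates : ∀ {x p} n → c x ≡ pick p → c (fold x s n) ≡ pick (parity n +ℙ p)
    walk-alternates 0 cx≡ = cx≡
    walk-alternates 1 cx≡ = edge-flips (edge _) cx≡
    walk-alternates {p = p} (suc (suc n)) cx≡ =
      subst (λ q → c (fold _ s (suc (suc n))) ≡ pick q) (⁻¹-involutive (parity n +ℙ p))
        (edge-flips (edge _) (edge-flips (edge _) (walk-alternates n cx≡)))

    closedWalk⇒even : ∀ x n → fold x s n ≡ x → parity n ≡ 0ℙ
    closedWalk⇒even x n closed with p , cx≡ ← endpoint-picked (edge x) =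
      +-cancelʳ-≡ p (parity n) 0ℙ (sym (pick-injective (begin
        pick p                ≡⟨ cx≡ ⟨
        c x                   ≡⟨ cong c closed ⟨
        c (fold x s n)        ≡⟨ walk-alternates n cx≡ ⟩
        pick (parity n +ℙ p)  ∎)))
      where open ≡-Reasoning

toℕ-cycSucc : ∀ {n} (j : Fin n) → suc (toℕ j) < n → toℕ (cycSucc j) ≡ suc (toℕ j)
toℕ-cycSucc {suc n} j j+1<n with suc (toℕ j) <? suc n
... | yes j+1<n′ = toℕ-fromℕ< j+1<n′
... | no j+1≮n = ⊥-elim (j+1≮n j+1<n)

cycSucc-fromℕ : ∀ n → cycSucc (fromℕ n) ≡ F.zero
cycSucc-fromℕ n with suc (toℕ (fromℕ n)) <? suc n
... | yes n+1<n+1 = ⊥-elim (<-irrefl (cong suc (toℕ-fromℕ n)) n+1<n+1)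
... | no _ = refl

toℕ-fold-cycSucc : ∀ {n} m → m < suc n → toℕ (fold (F.zero {n}) cycSucc m) ≡ m
toℕ-fold-cycSucc zero _ = refl
toℕ-fold-cycSucc {n} (suc m) m+1<n = begin
  toℕ (cycSucc (fold F.zero cycSucc m))  ≡⟨ toℕ-cycSucc _ (subst (_< suc n) (cong suc (sym ih)) m+1<n) ⟩
  suc (toℕ (fold F.zero cycSucc m))      ≡⟨ cong suc ih ⟩
  suc m                                  ∎
  where
  open ≡-Reasoning
  ih = toℕ-fold-cycSucc m (<-trans (n<1+n m) m+1<n)

fold-cycSucc-period : ∀ n → fold (F.zero {n}) cycSucc (suc n) ≡ F.zero
fold-cycSucc-period n = begin
  cycSucc (fold F.zero cycSucc n)  ≡⟨ cong cycSucc last≡fromℕ ⟩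
  cycSucc (fromℕ n)                ≡⟨ cycSucc-fromℕ n ⟩
  F.zero                           ∎
  where
  open ≡-Reasoning
  last≡fromℕ : fold F.zero cycSucc n ≡ fromℕ n
  last≡fromℕ = toℕ-injective (trans (toℕ-fold-cycSucc n (n<1+n n)) (sym (toℕ-fromℕ n)))

%2≡1⇒parity≡1ℙ : ∀ n → n % 2 ≡ 1 → parity n ≡ 1ℙ
%2≡1⇒parity≡1ℙ 1 _ = refl
%2≡1⇒parity≡1ℙ (suc (suc n)) n%2≡1 = %2≡1⇒parity≡1ℙ n n%2≡1

mainTheorem2 : (β : ℕ) → 1 ≤ β → (k : ℕ) → 3 ≤ k → k % 2 ≡ 1 →
    (v : Fin k → V β) → (∀ i j → v i ≡ v j → i ≡ j) →
    ¬ (∀ i j → SameColour (φ₁ β (v i) (v (cycSucc i))) (φ₁ β (v j) (v (cycSucc j))))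
mainTheorem2 β _ k@(suc (suc (suc n))) (s≤s (s≤s (s≤s _))) k-odd v v-injective monochromatic
  -- F.suc F.zero is cycSucc F.zero, by computation since k ≥ 2.
  with Colour.first (φ₁ β (v F.zero) (v (F.suc F.zero))) in first≡
... | nothing = 0≢1+n (v-injective _ _ (φ₁-first≡nothing⇒≡ β _ _ first≡))
... | just i = p≢p⁻¹ 1ℙ (trans (sym (%2≡1⇒parity≡1ℙ k k-odd)) k-even)
  where
  open Alternation (φ₁-first≡just⇒block≢ β (v F.zero) (v (F.suc F.zero)) first≡)
  cᵢ : Fin k → Vec Bool β
  cᵢ j = block β (v j) i
  edge : ∀ j → UPairEq (cᵢ j , cᵢ (cycSucc j)) (cᵢ F.zero , cᵢ (F.suc F.zero))
  edge j = sameColour⇒samePair β (v j) (v (cycSucc j)) (v F.zero) (v (F.suc F.zero))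
    first≡ (monochromatic j F.zero)
  k-even : parity k ≡ 0ℙ
  k-even = closedWalk⇒even cycSucc cᵢ edge F.zero k (fold-cycSucc-period (suc (suc n)))
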